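{- For all $\Gamma,\Delta\subseteq\mathcal{L}$ and every individual variable $x$, if $\Gamma\models\Delta$ (no pointed Chellas model satisfies all of $\Gamma$ and none of $\Delta$), then $Th\cup\{ST_x(\phi)\mid\phi\in\Gamma\}\models_{fo}\{ST_x(\psi)\mid\psi\in\Delta\}$.
   Context: $\mathcal{L}$ is built from a countably infinite set $Var$ of propositional variables and $\top,\bot$ by $\wedge,\vee,\to$ and conditional connectives $\phi\mathbin{\Box\!\!\to}\psi$, $\phi\mathbin{\Diamond\!\!\to}\psi$. A Chellas model is $\mathcal{M}=(W,\leq,R,V)$ with $W\neq\emptyset$, $\leq$ a preorder, $V$ assigning upward-closed sets to variables, $R\subseteq W\times\mathcal{P}(W)\times W$, $R_X(w,v)$ iff $(w,X,v)\in R$, satisfying for all $X\subseteq W$: (c1) $w\leq w'$ and $R_X(w,v)$ imply $R_X(w',v')$, $v\leq v'$ for some $v'$; (c2) $R_X(w,v)$ and $v\leq v'$ imply $w\leq w'$, $R_X(w',v')$ for some $w'$. Truth: $\top$ true, $\bot$ false, $p$ true at $w$ iff $w\in V(p)$, $\wedge,\vee$ pointwise, $\psi\to\chi$ true at $w$ iff at every $v\geq w$ truth of $\psi$ implies truth of $\chi$; $\psi\mathbin{\Box\!\!\to}\chi$ true at $w$ iff $\chi$ holds at every $u$ with $R_{\|\psi\|}(v,u)$ for some $v\geq w$; $\psi\mathbin{\Diamond\!\!\to}\chi$ true at $w$ iff $\chi$ holds at some $u$ with $R_{\|\psi\|}(w,u)$ ($\|\psi\|$ = set of worlds where $\psi$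 is true). First-order side: $\mathcal{L}_{fo}$ has atoms $px$ ($p\in Var$), $Rxyz$, $Ox$, $Sx$, $Exy$, $x\equiv y$, $\top,\bot$, connectives $\wedge,\vee,\to$, quantifiers; $(\forall x)_O\phi:=\forall x(Ox\to\phi)$. $\models_{fo}$ is intuitionistic first-order consequence via Kripke sheaves: a preorder of worlds, classical structures at each world for this signature, and homomorphisms $\mathbb{H}_{wv}$ for $w\leq v$ (identity for $w\leq w$, composing along chains), with the usual intuitionistic forcing clauses ($\to$ and $\forall$ quantify over all later worlds, transporting the assignment along $\mathbb{H}$; $\equiv$ is identity); $\Sigma\models_{fo}\Pi$ iff no world and assignment force all of $\Sigma$ and none of $\Pi$. $Th$ consists of: $\forall x(Sx\vee Ox)$; $\forall x\neg(Sx\wedge Ox)$; $\forall x(px\to Ox)$ for $p\in Var$; $\forall x\forall y(Exy\to(Ox\wedge Sy))$; $\forall x\forall y\forall z(Rxyz\to(Ox\wedge Sy\wedge Oz))$; $\exists x(Sx\wedge\forall y(Eyx\leftrightarrow py))$ for $p\in Var$; $\exists x(Sx\wedge(\forall y)_O Eyx)$; $\exists x(Sx\wedge\forall y\neg Eyx)$; $\forall x\forall y((Sx\wedge Sy)\to\exists z(Sz\wedge(\forall w)_O(Ewz\leftrightarrow(Ewx\ast Ewy))))$ for $\ast\in\{\wedge,\vee,\to\}$; $\forall x\forall y((Sx\wedge Sy)\to\exists z(Sz\wedge(\forall w)_O(Ewz\leftrightarrow\forall u(Rwxu\to Euy))))$; $\forall x\forall y((Sx\wedge Sy)\to\exists z(Sz\wedge(\forall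 w)_O(Ewz\leftrightarrow\exists u(Rwxu\wedge Euy))))$; $\forall x\forall y((Sx\wedge Sy\wedge(\forall z)_O(Ezx\leftrightarrow Ezy))\to x\equiv y)$. Standard translation (with $x,y,z,w$ pairwise distinct): $ST_x(p)=px$; $ST_x(\top)=\top$, $ST_x(\bot)=\bot$; $ST_x(\psi\ast\chi)=ST_x(\psi)\ast ST_x(\chi)$ for $\ast\in\{\wedge,\vee,\to\}$; $ST_x(\psi\mathbin{\Box\!\!\to}\chi)=\exists y(Sy\wedge(\forall z)_O(Ezy\leftrightarrow ST_z(\psi))\wedge\forall w(Rxyw\to ST_w(\chi)))$; $ST_x(\psi\mathbin{\Diamond\!\!\to}\chi)=\exists y(Sy\wedge(\forall z)_O(Ezy\leftrightarrow ST_z(\psi))\wedge\exists w(Rxyw\wedge ST_w(\chi)))$. -}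

module Defs where

open import Data.Nat using (ℕ; suc)
open import Data.Nat.Properties using (_≟_)
open import Data.Product using (Σ; _×_; _,_)
open import Data.Sum using (_⊎_)
open import Data.Empty using (⊥)
open import Data.Unit using (⊤)
open import Relation.Nullary using (¬_; yes; no)
open import Relation.Binary.PropositionalEquality using (_≡_)

infixr 6 _∧_
infixr 5 _∨_
infixr 4 _⇒_ _□→_ _◇→_

data Form : Set where
  var      : ℕ → Form
  ⊤'       : Form
  ⊥'       : Form
  _∧_      : Form → Form → Form
  _∨_      : Form → Form → Form
  _⇒_      : Form → Form → Form
  _□→_     : Form → Form → Form
  _◇→_     : Form → Form → Form

-- Since predicates are not extensional in Agda, we require R_X to depend
-- only on the extension of X (field R-ext); this is exactly the paper's
-- situation, where X ranges over sets.

record ChellasModel : Set₁ where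
  field
    W      : Set
    _≤_    : W → W → Set
    ≤-refl : ∀ {w} → w ≤ w
    ≤-trans : ∀ {u v w} → u ≤ v → v ≤ w → u ≤ w
    V      : ℕ → W → Set
    V-up   : ∀ p {w v} → w ≤ v → V p w → V p v
    R      : (W → Set) → W → W → Set
    R-ext  : ∀ (X Y : W → Set) → (∀ u → X u → Y u) → (∀ u → Y u → X u)
             → ∀ {w v} → R X w v → R Y w v
    c1     : ∀ (X : W → Set) {w w' v} → w ≤ w' → R X w v
             → Σ W (λ v' → R X w' v' × v ≤ v')
    c2     : ∀ (X : W → Set) {w v v'} → R X w v → v ≤ v'
             → Σ W (λ w' → w ≤ w' × R X w' v')

module _ (M : ChellasModel) where
  open ChellasModel M

  _⊩_ : W → Form → Set
  w ⊩ var p    = V p w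
  w ⊩ ⊤'       = ⊤
  w ⊩ ⊥'       = ⊥
  w ⊩ (φ ∧ ψ)  = (w ⊩ φ) × (w ⊩ ψ)
  w ⊩ (φ ∨ ψ)  = (w ⊩ φ) ⊎ (w ⊩ ψ)
  w ⊩ (φ ⇒ ψ)  = ∀ v → w ≤ v → v ⊩ φ → v ⊩ ψ
  w ⊩ (φ □→ ψ) = ∀ v → w ≤ v → ∀ u → R (λ t → t ⊩ φ) v u → u ⊩ ψ
  w ⊩ (φ ◇→ ψ) = Σ W (λ u → R (λ t → t ⊩ φ) w u × u ⊩ ψ)

_⊨_ : (Form → Set) → (Form → Set) → Set₁
Γ ⊨ Δ = ∀ (M : ChellasModel) (w : ChellasModel.W M)
        → (∀ φ → Γ φ → _⊩_ M w φ)
        → (∀ ψ → Δ ψ → ¬ (_⊩_ M w ψ))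
        → ⊥

infixr 6 _∧ᶠ_
infixr 5 _∨ᶠ_
infixr 4 _⇒ᶠ_ _⇔ᶠ_

data FO : Set where
  P     : ℕ → ℕ → FO
  Rᶠ    : ℕ → ℕ → ℕ → FO
  Oᶠ    : ℕ → FO
  Sᶠ    : ℕ → FO
  Eᶠ    : ℕ → ℕ → FO
  _≐_   : ℕ → ℕ → FO
  ⊤ᶠ    : FO
  ⊥ᶠ    : FO
  _∧ᶠ_  : FO → FO → FO
  _∨ᶠ_  : FO → FO → FO
  _⇒ᶠ_  : FO → FO → FO
  ∀ᶠ    : ℕ → FO → FO
  ∃ᶠ    : ℕ → FO → FO

¬ᶠ : FO → FO
¬ᶠ φ = φ ⇒ᶠ ⊥ᶠ

_⇔ᶠ_ : FO → FO → FO
φ ⇔ᶠ ψ = (φ ⇒ᶠ ψ) ∧ᶠ (ψ ⇒ᶠ φ)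

∀O : ℕ → FO → FO
∀O x φ = ∀ᶠ x (Oᶠ x ⇒ᶠ φ)

record KripkeSheaf : Set₁ where
  field
    K       : Set
    _≼_     : K → K → Set
    ≼-refl  : ∀ {w} → w ≼ w
    ≼-trans : ∀ {u v w} → u ≼ v → v ≼ w → u ≼ w
    D       : K → Set
    Pᴵ      : ∀ {w} → ℕ → D w → Set
    Rᴵ      : ∀ {w} → D w → D w → D w → Set
    Oᴵ      : ∀ {w} → D w → Set
    Sᴵ      : ∀ {w} → D w → Set
    Eᴵ      : ∀ {w} → D w → D w → Set
    H       : ∀ {w v} → w ≼ v → D w → D v
    H-id    : ∀ {w} (e : w ≼ w) d → H e d ≡ d
    H-comp  : ∀ {u v w} (e₁ : u ≼ v) (e₂ : v ≼ w) (e₃ : u ≼ w) d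
              → H e₃ d ≡ H e₂ (H e₁ d)
    H-P     : ∀ {w v} (e : w ≼ v) p {a} → Pᴵ p a → Pᴵ p (H e a)
    H-R     : ∀ {w v} (e : w ≼ v) {a b c} → Rᴵ a b c → Rᴵ (H e a) (H e b) (H e c)
    H-O     : ∀ {w v} (e : w ≼ v) {a} → Oᴵ a → Oᴵ (H e a)
    H-S     : ∀ {w v} (e : w ≼ v) {a} → Sᴵ a → Sᴵ (H e a)
    H-E     : ∀ {w v} (e : w ≼ v) {a b} → Eᴵ a b → Eᴵ (H e a) (H e b)

module _ (𝔎 : KripkeSheaf) where
  open KripkeSheaf 𝔎

  upd : ∀ {w} → (ℕ → D w) → ℕ → D w → ℕ → D w
  upd g x d y with y ≟ x
  ... | yes _ = d
  ... | no  _ = g y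

  _,_⊩ᶠ_ : (w : K) → (ℕ → D w) → FO → Set
  w , g ⊩ᶠ P p x     = Pᴵ p (g x)
  w , g ⊩ᶠ Rᶠ x y z  = Rᴵ (g x) (g y) (g z)
  w , g ⊩ᶠ Oᶠ x      = Oᴵ (g x)
  w , g ⊩ᶠ Sᶠ x      = Sᴵ (g x)
  w , g ⊩ᶠ Eᶠ x y    = Eᴵ (g x) (g y)
  w , g ⊩ᶠ (x ≐ y)   = g x ≡ g y
  w , g ⊩ᶠ ⊤ᶠ        = ⊤
  w , g ⊩ᶠ ⊥ᶠ        = ⊥
  w , g ⊩ᶠ (φ ∧ᶠ ψ)  = (w , g ⊩ᶠ φ) × (w , g ⊩ᶠ ψ)
  w , g ⊩ᶠ (φ ∨ᶠ ψ)  = (w , g ⊩ᶠ φ) ⊎ (w , g ⊩ᶠ ψ)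
  w , g ⊩ᶠ (φ ⇒ᶠ ψ)  = ∀ v (e : w ≼ v)
                       → v , (λ y → H e (g y)) ⊩ᶠ φ → v , (λ y → H e (g y)) ⊩ᶠ ψ
  w , g ⊩ᶠ ∀ᶠ x φ    = ∀ v (e : w ≼ v) (d : D v) → v , upd (λ y → H e (g y)) x d ⊩ᶠ φ
  w , g ⊩ᶠ ∃ᶠ x φ    = Σ (D w) (λ d → w , upd g x d ⊩ᶠ φ)

_⊨fo_ : (FO → Set) → (FO → Set) → Set₁
Σ' ⊨fo Π = ∀ (𝔎 : KripkeSheaf) (w : KripkeSheaf.K 𝔎) (g : ℕ → KripkeSheaf.D 𝔎 w)
           → (∀ φ → Σ' φ → _,_⊩ᶠ_ 𝔎 w g φ)
           → (∀ ψ → Π ψ → ¬ (_,_⊩ᶠ_ 𝔎 w g ψ))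
           → ⊥

module ThVars where
  x y z w u : ℕ
  x = 0
  y = 1
  z = 2
  w = 3
  u = 4
open ThVars

data Th : FO → Set where
  th-SO    : Th (∀ᶠ x (Sᶠ x ∨ᶠ Oᶠ x))
  th-disj  : Th (∀ᶠ x (¬ᶠ (Sᶠ x ∧ᶠ Oᶠ x)))
  th-pO    : ∀ p → Th (∀ᶠ x (P p x ⇒ᶠ Oᶠ x))
  th-E     : Th (∀ᶠ x (∀ᶠ y (Eᶠ x y ⇒ᶠ (Oᶠ x ∧ᶠ Sᶠ y))))
  th-R     : Th (∀ᶠ x (∀ᶠ y (∀ᶠ z (Rᶠ x y z ⇒ᶠ (Oᶠ x ∧ᶠ Sᶠ y ∧ᶠ Oᶠ z)))))
  th-var   : ∀ p → Th (∃ᶠ x (Sᶠ x ∧ᶠ ∀ᶠ y (Eᶠ y x ⇔ᶠ P p y)))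
  th-top   : Th (∃ᶠ x (Sᶠ x ∧ᶠ ∀O y (Eᶠ y x)))
  th-bot   : Th (∃ᶠ x (Sᶠ x ∧ᶠ ∀ᶠ y (¬ᶠ (Eᶠ y x))))
  th-and   : Th (∀ᶠ x (∀ᶠ y ((Sᶠ x ∧ᶠ Sᶠ y) ⇒ᶠ
               ∃ᶠ z (Sᶠ z ∧ᶠ ∀O w (Eᶠ w z ⇔ᶠ (Eᶠ w x ∧ᶠ Eᶠ w y))))))
  th-or    : Th (∀ᶠ x (∀ᶠ y ((Sᶠ x ∧ᶠ Sᶠ y) ⇒ᶠ
               ∃ᶠ z (Sᶠ z ∧ᶠ ∀O w (Eᶠ w z ⇔ᶠ (Eᶠ w x ∨ᶠ Eᶠ w y))))))
  th-imp   : Th (∀ᶠ x (∀ᶠ y ((Sᶠ x ∧ᶠ Sᶠ y) ⇒ᶠ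
               ∃ᶠ z (Sᶠ z ∧ᶠ ∀O w (Eᶠ w z ⇔ᶠ (Eᶠ w x ⇒ᶠ Eᶠ w y))))))
  th-box   : Th (∀ᶠ x (∀ᶠ y ((Sᶠ x ∧ᶠ Sᶠ y) ⇒ᶠ
               ∃ᶠ z (Sᶠ z ∧ᶠ ∀O w (Eᶠ w z ⇔ᶠ ∀ᶠ u (Rᶠ w x u ⇒ᶠ Eᶠ u y))))))
  th-dia   : Th (∀ᶠ x (∀ᶠ y ((Sᶠ x ∧ᶠ Sᶠ y) ⇒ᶠ
               ∃ᶠ z (Sᶠ z ∧ᶠ ∀O w (Eᶠ w z ⇔ᶠ ∃ᶠ u (Rᶠ w x u ∧ᶠ Eᶠ u y))))))
  th-ext   : Th (∀ᶠ x (∀ᶠ y ((Sᶠ x ∧ᶠ Sᶠ y ∧ᶠ ∀O z (Eᶠ z x ⇔ᶠ Eᶠ z y)) ⇒ᶠ (x ≐ y))))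

-- Standard translation.  For ST_x we fix the pairwise distinct auxiliary
-- variables  y = x+1, z = x+2, w = x+3.

ST : ℕ → Form → FO
ST x (var p)   = P p x
ST x ⊤'        = ⊤ᶠ
ST x ⊥'        = ⊥ᶠ
ST x (φ ∧ ψ)   = ST x φ ∧ᶠ ST x ψ
ST x (φ ∨ ψ)   = ST x φ ∨ᶠ ST x ψ
ST x (φ ⇒ ψ)   = ST x φ ⇒ᶠ ST x ψ
ST x (φ □→ ψ)  =
  ∃ᶠ (suc x) (Sᶠ (suc x)
    ∧ᶠ ∀O (suc (suc x)) (Eᶠ (suc (suc x)) (suc x) ⇔ᶠ ST (suc (suc x)) φ)
    ∧ᶠ ∀ᶠ (suc (suc (suc x))) (Rᶠ x (suc x) (suc (suc (suc x))) ⇒ᶠ ST (suc (suc (suc x))) ψ))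
ST x (φ ◇→ ψ)  =
  ∃ᶠ (suc x) (Sᶠ (suc x)
    ∧ᶠ ∀O (suc (suc x)) (Eᶠ (suc (suc x)) (suc x) ⇔ᶠ ST (suc (suc x)) φ)
    ∧ᶠ ∃ᶠ (suc (suc (suc x))) (Rᶠ x (suc x) (suc (suc (suc x))) ∧ᶠ ST (suc (suc (suc x))) ψ))

ThST : ℕ → (Form → Set) → FO → Set
ThST x Γ χ = Th χ ⊎ Σ Form (λ φ → Γ φ × χ ≡ ST x φ)

STset : ℕ → (Form → Set) → FO → Set
STset x Δ χ = Σ Form (λ ψ → Δ ψ × χ ≡ ST x ψ)

{-# OPTIONS --safe #-}

-- Canonical-model argument. Given a Kripke sheaf, a world w₀ and an assignment g₀ forcing Th and
-- the translation of Γ, take as Chellas worlds the pairs (v , d) of a world v and an element d of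
-- its domain, ordered along the transition maps, and let R_X relate (v , a) to (v , b) when
-- Rᴵ a t b for an S-element t at some v above w₀ whose O-members at all later worlds are exactly
-- the points of X. Above w₀ the comprehension axioms of Th make the truth set of every formula
-- definable in this sense, and extensionality makes the defining element unique. Together they
-- give the truth lemma: φ holds at (v , h m) iff ST m φ is forced at v under h, which turns a
-- Kripke-sheaf countermodel into a Chellas countermodel at (w₀ , g₀ x).

module Submission where

open import Data.Nat using (ℕ; suc; _+_)
open import Data.Nat.Properties using (_≟_; m≢1+n+m)
open import Data.Product using (Σ; _×_; _,_; proj₂)
open import Data.Product.Function.NonDependent.Propositional using (_×-⇔_)
open import Data.Sum using (inj₁; inj₂)
open import Data.Sum.Function.Propositional using (_⊎-⇔_)
open import Data.Empty using (⊥-elim)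
open import Data.Unit using (tt)
open import Function using (id; _∘_)
open import Function.Bundles using (_⇔_; mk⇔; Equivalence)
open import Function.Construct.Composition using (_⇔-∘_)
open import Function.Construct.Symmetry using (⇔-sym)
open import Relation.Nullary using (yes; no)
open import Relation.Binary.PropositionalEquality
  using (_≡_; _≢_; refl; sym; trans; cong; subst; subst₂; _≗_)
open import Defs

open Equivalence using (to; from)

module KripkeForcing (𝔎 : KripkeSheaf) where
  open KripkeSheaf 𝔎

  Assignment : K → Set
  Assignment w = ℕ → D w

  infix 3.5 _∣_⊩_
  _∣_⊩_ : (w : K) → Assignment w → FO → Set
  w ∣ g ⊩ φ = _,_⊩ᶠ_ 𝔎 w g φ

  infixl 9 _[_↦_]
  _[_↦_] : ∀ {w} → Assignment w → ℕ → D w → Assignment w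
  g [ x ↦ d ] = upd 𝔎 g x d

  transport : ∀ {w v} → w ≼ v → Assignment w → Assignment v
  transport e g y = H e (g y)

  upd-≡ : ∀ {w} (g : Assignment w) x d → (g [ x ↦ d ]) x ≡ d
  upd-≡ g x d with x ≟ x
  ... | yes _  = refl
  ... | no x≢x = ⊥-elim (x≢x refl)

  upd-≢ : ∀ {w} (g : Assignment w) {x} d {y} → y ≢ x → (g [ x ↦ d ]) y ≡ g y
  upd-≢ g {x} d {y} y≢x with y ≟ x
  ... | yes y≡x = ⊥-elim (y≢x y≡x)
  ... | no _    = refl

  transport-upd : ∀ {w v} (e : w ≼ v) {g : Assignment w} {x d}
                → transport e (g [ x ↦ d ]) ≗ transport e g [ x ↦ H e d ]
  transport-upd e {x = x} y with y ≟ x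
  ... | yes _ = refl
  ... | no _  = refl

  upd-cong : ∀ {w} {g g' : Assignment w} x d → g ≗ g' → g [ x ↦ d ] ≗ g' [ x ↦ d ]
  upd-cong x d g≗g' y with y ≟ x
  ... | yes _ = refl
  ... | no _  = g≗g' y

  transport-refl : ∀ {w} (g : Assignment w) → transport ≼-refl g ≗ g
  transport-refl g y = H-id ≼-refl (g y)

  transport-trans : ∀ {u v w} (e₁ : u ≼ v) (e₂ : v ≼ w) (g : Assignment u)
                  → transport (≼-trans e₁ e₂) g ≗ transport e₂ (transport e₁ g)
  transport-trans e₁ e₂ g y = H-comp e₁ e₂ (≼-trans e₁ e₂) (g y)

  Rᴵ-resp : ∀ {w} {a a' t t' b b' : D w} → a ≡ a' → t ≡ t' → b ≡ b' → Rᴵ a t b → Rᴵ a' t' b'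
  Rᴵ-resp refl refl refl = id

  ⊩-cong : ∀ φ {w} {g g' : Assignment w} → g ≗ g' → w ∣ g ⊩ φ → w ∣ g' ⊩ φ
  ⊩-cong (P p x)    g≗g' f = subst (Pᴵ p) (g≗g' x) f
  ⊩-cong (Rᶠ x y z) g≗g' f = Rᴵ-resp (g≗g' x) (g≗g' y) (g≗g' z) f
  ⊩-cong (Oᶠ x)     g≗g' f = subst Oᴵ (g≗g' x) f
  ⊩-cong (Sᶠ x)     g≗g' f = subst Sᴵ (g≗g' x) f
  ⊩-cong (Eᶠ x y)   g≗g' f = subst₂ Eᴵ (g≗g' x) (g≗g' y) f
  ⊩-cong (x ≐ y)    g≗g' f = trans (sym (g≗g' x)) (trans f (g≗g' y))
  ⊩-cong ⊤ᶠ         g≗g' f = f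
  ⊩-cong ⊥ᶠ         g≗g' ()
  ⊩-cong (φ ∧ᶠ ψ)   g≗g' (a , b) = ⊩-cong φ g≗g' a , ⊩-cong ψ g≗g' b
  ⊩-cong (φ ∨ᶠ ψ)   g≗g' (inj₁ a) = inj₁ (⊩-cong φ g≗g' a)
  ⊩-cong (φ ∨ᶠ ψ)   g≗g' (inj₂ b) = inj₂ (⊩-cong ψ g≗g' b)
  ⊩-cong (φ ⇒ᶠ ψ)   g≗g' f v e a =
    ⊩-cong ψ (λ y → cong (H e) (g≗g' y)) (f v e (⊩-cong φ (λ y → cong (H e) (sym (g≗g' y))) a))
  ⊩-cong (∀ᶠ x φ)   g≗g' f v e d = ⊩-cong φ (upd-cong x d (λ y → cong (H e) (g≗g' y))) (f v e d)
  ⊩-cong (∃ᶠ x φ)   g≗g' (d , f) = d , ⊩-cong φ (upd-cong x d g≗g') f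

  ⊩-mp : ∀ {w} (g : Assignment w) φ ψ → w ∣ g ⊩ φ ⇒ᶠ ψ → w ∣ g ⊩ φ → w ∣ g ⊩ ψ
  ⊩-mp g φ ψ f a =
    ⊩-cong ψ (transport-refl g) (f _ ≼-refl (⊩-cong φ (λ y → sym (transport-refl g y)) a))

  ⊩-⇔-elim : ∀ {w} (g : Assignment w) φ ψ → w ∣ g ⊩ φ ⇔ᶠ ψ → (w ∣ g ⊩ φ) ⇔ (w ∣ g ⊩ ψ)
  ⊩-⇔-elim g φ ψ (f , f⁻¹) = mk⇔ (⊩-mp g φ ψ f) (⊩-mp g ψ φ f⁻¹)

  ⊩-⇔-intro : ∀ {w} (g : Assignment w) φ ψ
            → (∀ v (e : w ≼ v) → (v ∣ transport e g ⊩ φ) ⇔ (v ∣ transport e g ⊩ ψ))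
            → w ∣ g ⊩ φ ⇔ᶠ ψ
  ⊩-⇔-intro g φ ψ h = (λ v e → to (h v e)) , (λ v e → from (h v e))

  ⊩-∀-inst : ∀ {w} (g : Assignment w) x φ → w ∣ g ⊩ ∀ᶠ x φ → (d : D w) → w ∣ g [ x ↦ d ] ⊩ φ
  ⊩-∀-inst g x φ f d = ⊩-cong φ (upd-cong x d (transport-refl g)) (f _ ≼-refl d)

  ⊩-∀⇒-elim : ∀ {w} (g : Assignment w) x φ ψ → w ∣ g ⊩ ∀ᶠ x (φ ⇒ᶠ ψ)
            → ∀ v (e : w ≼ v) d → v ∣ transport e g [ x ↦ d ] ⊩ φ → v ∣ transport e g [ x ↦ d ] ⊩ ψ
  ⊩-∀⇒-elim g x φ ψ f v e d = ⊩-mp (transport e g [ x ↦ d ]) φ ψ (f v e d)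

  ⊩-∀⇒-intro : ∀ {w} (g : Assignment w) x φ ψ
             → (∀ v (e : w ≼ v) d → v ∣ transport e g [ x ↦ d ] ⊩ φ → v ∣ transport e g [ x ↦ d ] ⊩ ψ)
             → w ∣ g ⊩ ∀ᶠ x (φ ⇒ᶠ ψ)
  ⊩-∀⇒-intro g x φ ψ h v e d v' e' a =
    ⊩-cong ψ (λ y → sym (transported y)) (h v' (≼-trans e e') (H e' d) (⊩-cong φ transported a))
    where
    transported : transport e' (transport e g [ x ↦ d ]) ≗ transport (≼-trans e e') g [ x ↦ H e' d ]
    transported y = trans (transport-upd e' y)
                          (upd-cong x (H e' d) (λ y' → sym (transport-trans e e' g y')) y)

module CanonicalModel (𝔎 : KripkeSheaf) (w₀ : KripkeSheaf.K 𝔎) (g₀ : ℕ → KripkeSheaf.D 𝔎 w₀)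
                      (Th-forced : ∀ χ → Th χ → _,_⊩ᶠ_ 𝔎 w₀ g₀ χ) where
  open KripkeSheaf 𝔎
  open KripkeForcing 𝔎

  R-target-O : ∀ {v} {a t b : D v} → w₀ ≼ v → Rᴵ a t b → Oᴵ b
  R-target-O {a = a} {t} {b} r Rabt = proj₂ (proj₂ (⊩-mp ρ₃ (Rᶠ 0 1 2) typing instantiated Rabt))
    where
    typing = Oᶠ 0 ∧ᶠ Sᶠ 1 ∧ᶠ Oᶠ 2
    ρ₁ = transport r g₀ [ 0 ↦ a ]
    ρ₃ = ρ₁ [ 1 ↦ t ] [ 2 ↦ b ]
    instantiated = ⊩-∀-inst (ρ₁ [ 1 ↦ t ]) 2 (Rᶠ 0 1 2 ⇒ᶠ typing)
                     (⊩-∀-inst ρ₁ 1 (∀ᶠ 2 (Rᶠ 0 1 2 ⇒ᶠ typing)) (Th-forced _ th-R _ r a) t) b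

  Point : Set
  Point = Σ K D

  _≤ₚ_ : Point → Point → Set
  (v , a) ≤ₚ (v' , a') = Σ (v ≼ v') λ e → H e a ≡ a'

  ≤ₚ-trans : ∀ {p q s} → p ≤ₚ q → q ≤ₚ s → p ≤ₚ s
  ≤ₚ-trans {_ , a} (e₁ , refl) (e₂ , refl) = ≼-trans e₁ e₂ , H-comp e₁ e₂ _ a

  Defines : (Point → Set) → (v : K) → D v → Set
  Defines X v t = ∀ v' (e : v ≼ v') c → Oᴵ c → Eᴵ c (H e t) ⇔ X (v' , c)

  defines-mono : ∀ {X v v' t} (e : v ≼ v') → Defines X v t → Defines X v' (H e t)
  defines-mono {X} {t = t} e d v'' e' c o =
    subst (λ t' → Eᴵ c t' ⇔ X (v'' , c)) (H-comp e e' _ t) (d v'' (≼-trans e e') c o)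

  defines-ext : ∀ {X Y v t} → (∀ p → X p ⇔ Y p) → Defines X v t → Defines Y v t
  defines-ext X⇔Y d v' e c o = X⇔Y (v' , c) ⇔-∘ d v' e c o

  data Reach (X : Point → Set) : Point → Point → Set where
    reach : ∀ {v a b} → w₀ ≼ v → (t : D v) → Sᴵ t → Defines X v t → Rᴵ a t b → Reach X (v , a) (v , b)

  reach-forth : ∀ X {p p' q} → p ≤ₚ p' → Reach X p q → Σ Point λ q' → Reach X p' q' × q ≤ₚ q'
  reach-forth X (e , refl) (reach {b = b} r t St dt Rt) =
    (_ , H e b) , reach (≼-trans r e) (H e t) (H-S e St) (defines-mono e dt) (H-R e Rt) , (e , refl)

  reach-back : ∀ X {p q q'} → Reach X p q → q ≤ₚ q' → Σ Point λ p' → p ≤ₚ p' × Reach X p' q'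
  reach-back X (reach {a = a} r t St dt Rt) (e , refl) =
    (_ , H e a) , (e , refl) , reach (≼-trans r e) (H e t) (H-S e St) (defines-mono e dt) (H-R e Rt)

  model : ChellasModel
  model = record
    { W       = Point
    ; _≤_     = _≤ₚ_
    ; ≤-refl  = ≼-refl , H-id _ _
    ; ≤-trans = ≤ₚ-trans
    ; V       = λ p (_ , a) → Pᴵ p a
    ; V-up    = λ { p (e , refl) Pa → H-P e p Pa }
    ; R       = Reach
    ; R-ext   = λ { X Y X⊆Y Y⊆X (reach r t St dt Rt) →
                    reach r t St (defines-ext (λ p → mk⇔ (X⊆Y p) (Y⊆X p)) dt) Rt }
    ; c1      = reach-forth
    ; c2      = reach-back
    }

  ⟦_⟧ : Form → Point → Set
  ⟦ φ ⟧ p = _⊩_ model p φ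

  Definable : (Point → Set) → K → Set
  Definable X v = Σ (D v) λ t → Sᴵ t × Defines X v t

  definable-mono : ∀ {X v v'} → v ≼ v' → Definable X v → Definable X v'
  definable-mono e (t , St , dt) = H e t , H-S e St , defines-mono e dt

  definers-agree : ∀ {X v v' t t' c} → Defines X v t → Defines X v t'
                  → (e : v ≼ v') → Oᴵ c → Eᴵ c (H e t) → Eᴵ c (H e t')
  definers-agree dt dt' e o = from (dt' _ e _ o) ∘ to (dt _ e _ o)

  defines-unique : ∀ {X v t t'} → w₀ ≼ v → Sᴵ t → Sᴵ t' → Defines X v t → Defines X v t' → t ≡ t'
  defines-unique {v = v} {t} {t'} r St St' dt dt' =
    ⊩-mp ρ premise (0 ≐ 1) (⊩-∀-inst ρ₀ 1 (premise ⇒ᶠ (0 ≐ 1)) (Th-forced _ th-ext _ r t) t')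
      (St , St' , ⊩-∀⇒-intro ρ 2 (Oᶠ 2) (Eᶠ 2 0 ⇔ᶠ Eᶠ 2 1) same-members)
    where
    premise = Sᶠ 0 ∧ᶠ Sᶠ 1 ∧ᶠ ∀O 2 (Eᶠ 2 0 ⇔ᶠ Eᶠ 2 1)
    ρ₀ = transport r g₀ [ 0 ↦ t ]
    ρ = ρ₀ [ 1 ↦ t' ]
    same-members : ∀ v' (e : v ≼ v') c → Oᴵ c → v' ∣ transport e ρ [ 2 ↦ c ] ⊩ Eᶠ 2 0 ⇔ᶠ Eᶠ 2 1
    same-members v' e c o =
        (λ _ e' → definers-agree (defines-mono e dt) (defines-mono e dt') e' (H-O e' o))
      , (λ _ e' → definers-agree (defines-mono e dt') (defines-mono e dt) e' (H-O e' o))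

  Comprehension : FO → FO
  Comprehension B = ∀ᶠ 0 (∀ᶠ 1 ((Sᶠ 0 ∧ᶠ Sᶠ 1) ⇒ᶠ ∃ᶠ 2 (Sᶠ 2 ∧ᶠ ∀O 3 (Eᶠ 3 2 ⇔ᶠ B))))

  frame : ∀ {v v'} → w₀ ≼ v → (s₁ s₂ s : D v) → v ≼ v' → D v' → Assignment v'
  frame r s₁ s₂ s e c = transport e (transport r g₀ [ 0 ↦ s₁ ] [ 1 ↦ s₂ ] [ 2 ↦ s ]) [ 3 ↦ c ]

  -- s is the comprehension set of B, whose variables 0, 1 and 3 stand for s₁, s₂ and the member c.
  Comprehends : ∀ {v} → w₀ ≼ v → (s₁ s₂ s : D v) → FO → Set
  Comprehends {v} r s₁ s₂ s B =
    ∀ v' (e : v ≼ v') c → Oᴵ c → Eᴵ c (H e s) ⇔ v' ∣ frame r s₁ s₂ s e c ⊩ B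

  comprehension : ∀ {v} B → w₀ ∣ g₀ ⊩ Comprehension B → (r : w₀ ≼ v) → ∀ {s₁ s₂} → Sᴵ s₁ → Sᴵ s₂
                → Σ (D v) λ s → Sᴵ s × Comprehends r s₁ s₂ s B
  comprehension B comp r {s₁} {s₂} S₁ S₂ =
    let s , Ss , members = ⊩-mp ρ (Sᶠ 0 ∧ᶠ Sᶠ 1) conclusion
                             (⊩-∀-inst ρ₀ 1 ((Sᶠ 0 ∧ᶠ Sᶠ 1) ⇒ᶠ conclusion) (comp _ r s₁) s₂) (S₁ , S₂)
    in s , Ss , λ v' e c o →
         ⊩-⇔-elim (frame r s₁ s₂ s e c) (Eᶠ 3 2) B
           (⊩-∀⇒-elim (ρ [ 2 ↦ s ]) 3 (Oᶠ 3) (Eᶠ 3 2 ⇔ᶠ B) members v' e c o)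
    where
    conclusion = ∃ᶠ 2 (Sᶠ 2 ∧ᶠ ∀O 3 (Eᶠ 3 2 ⇔ᶠ B))
    ρ₀ = transport r g₀ [ 0 ↦ s₁ ]
    ρ = ρ₀ [ 1 ↦ s₂ ]

  definable-by : ∀ {v X Y Z B} → Th (Comprehension B) → (r : w₀ ≼ v)
               → (∀ {s₁ s₂ s} → Sᴵ s₁ → Defines X v s₁ → Defines Y v s₂ → Comprehends r s₁ s₂ s B
                  → Defines Z v s)
               → Definable X v → Definable Y v → Definable Z v
  definable-by {B = B} axiom r rule (s₁ , S₁ , d₁) (s₂ , S₂ , d₂) =
    let s , Ss , members = comprehension B (Th-forced _ axiom) r S₁ S₂
    in s , Ss , rule S₁ d₁ d₂ members

  definable-var : ∀ p → Definable ⟦ var p ⟧ w₀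
  definable-var p =
    let s , Ss , members = Th-forced _ (th-var p)
    in s , Ss , λ v' e c _ →
         ⊩-⇔-elim (transport e (g₀ [ 0 ↦ s ]) [ 1 ↦ c ]) (Eᶠ 1 0) (P p 1) (members v' e c)

  definable-⊤ : Definable ⟦ ⊤' ⟧ w₀
  definable-⊤ =
    let s , Ss , members = Th-forced _ th-top
    in s , Ss , λ v' e c o →
         mk⇔ (λ _ → tt) (λ _ → ⊩-∀⇒-elim (g₀ [ 0 ↦ s ]) 1 (Oᶠ 1) (Eᶠ 1 0) members v' e c o)

  definable-⊥ : Definable ⟦ ⊥' ⟧ w₀
  definable-⊥ =
    let s , Ss , nonmembers = Th-forced _ th-bot
    in s , Ss , λ v' e c _ →
         mk⇔ (⊩-∀⇒-elim (g₀ [ 0 ↦ s ]) 1 (Eᶠ 1 0) ⊥ᶠ nonmembers v' e c) λ ()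

  module _ {v} (r : w₀ ≼ v) (φ ψ : Form) {s₁ s₂ s : D v} where

    defines-∧ : Defines ⟦ φ ⟧ v s₁ → Defines ⟦ ψ ⟧ v s₂
              → Comprehends r s₁ s₂ s (Eᶠ 3 0 ∧ᶠ Eᶠ 3 1) → Defines ⟦ φ ∧ ψ ⟧ v s
    defines-∧ d₁ d₂ comp v' e c o = (d₁ v' e c o ×-⇔ d₂ v' e c o) ⇔-∘ comp v' e c o

    defines-∨ : Defines ⟦ φ ⟧ v s₁ → Defines ⟦ ψ ⟧ v s₂
              → Comprehends r s₁ s₂ s (Eᶠ 3 0 ∨ᶠ Eᶠ 3 1) → Defines ⟦ φ ∨ ψ ⟧ v s
    defines-∨ d₁ d₂ comp v' e c o = (d₁ v' e c o ⊎-⇔ d₂ v' e c o) ⇔-∘ comp v' e c o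

    defines-⇒ : Defines ⟦ φ ⟧ v s₁ → Defines ⟦ ψ ⟧ v s₂
              → Comprehends r s₁ s₂ s (Eᶠ 3 0 ⇒ᶠ Eᶠ 3 1) → Defines ⟦ φ ⇒ ψ ⟧ v s
    defines-⇒ d₁ d₂ comp v' e c o = mk⇔
      (λ x → λ { (v'' , _) (e' , refl) φc → to (d₂' v'' e' _ (H-O e' o))
                   (to (comp v' e c o) x v'' e' (from (d₁' v'' e' _ (H-O e' o)) φc)) })
      (λ f → from (comp v' e c o) λ v'' e' Ec → from (d₂' v'' e' _ (H-O e' o))
               (f (v'' , H e' c) (e' , refl) (to (d₁' v'' e' _ (H-O e' o)) Ec)))
      where
      d₁' = defines-mono e d₁
      d₂' = defines-mono e d₂

    defines-□→ : Sᴵ s₁ → Defines ⟦ φ ⟧ v s₁ → Defines ⟦ ψ ⟧ v s₂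
               → Comprehends r s₁ s₂ s (∀ᶠ 4 (Rᶠ 3 0 4 ⇒ᶠ Eᶠ 4 1)) → Defines ⟦ φ □→ ψ ⟧ v s
    defines-□→ S₁ d₁ d₂ comp v' e c o = mk⇔
      (λ x → λ { _ (e' , refl) _ (reach r' t St dt Rt) →
        let t≡s₁ = defines-unique r' St (H-S e' (H-S e S₁)) dt (defines-mono e' (defines-mono e d₁))
        in to (defines-mono e d₂ _ e' _ (R-target-O r' Rt))
              (⊩-∀⇒-elim (frame r s₁ s₂ s e c) 4 (Rᶠ 3 0 4) (Eᶠ 4 1) (to (comp v' e c o) x)
                 _ e' _ (subst (λ t' → Rᴵ _ t' _) t≡s₁ Rt)) })
      (λ f → from (comp v' e c o)
        (⊩-∀⇒-intro (frame r s₁ s₂ s e c) 4 (Rᶠ 3 0 4) (Eᶠ 4 1) λ v'' e' b Rb →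
          let r' = ≼-trans r (≼-trans e e')
          in from (defines-mono e d₂ v'' e' b (R-target-O r' Rb))
               (f (v'' , H e' c) (e' , refl) (v'' , b)
                  (reach r' _ (H-S e' (H-S e S₁)) (defines-mono e' (defines-mono e d₁)) Rb))))

    defines-◇→ : Sᴵ s₁ → Defines ⟦ φ ⟧ v s₁ → Defines ⟦ ψ ⟧ v s₂
               → Comprehends r s₁ s₂ s (∃ᶠ 4 (Rᶠ 3 0 4 ∧ᶠ Eᶠ 4 1)) → Defines ⟦ φ ◇→ ψ ⟧ v s
    defines-◇→ S₁ d₁ d₂ comp v' e c o = mk⇔
      (λ x → let b , Rb , Eb = to (comp v' e c o) x
             in (v' , b) , reach (≼-trans r e) _ (H-S e S₁) (defines-mono e d₁) Rb
                , to (d₂ v' e b (R-target-O (≼-trans r e) Rb)) Eb)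
      (λ { (_ , reach r' t St dt Rt , ψb) → from (comp v' e c o)
             ( _ , subst (λ t' → Rᴵ c t' _) (defines-unique r' St (H-S e S₁) dt (defines-mono e d₁)) Rt
             , from (d₂ v' e _ (R-target-O r' Rt)) ψb) })

  definable : ∀ φ {v} → w₀ ≼ v → Definable ⟦ φ ⟧ v
  definable (var p)  r = definable-mono r (definable-var p)
  definable ⊤'       r = definable-mono r definable-⊤
  definable ⊥'       r = definable-mono r definable-⊥
  definable (φ ∧ ψ)  r = definable-by th-and r (λ _ → defines-∧ r φ ψ) (definable φ r) (definable ψ r)
  definable (φ ∨ ψ)  r = definable-by th-or  r (λ _ → defines-∨ r φ ψ) (definable φ r) (definable ψ r)
  definable (φ ⇒ ψ)  r = definable-by th-imp r (λ _ → defines-⇒ r φ ψ) (definable φ r) (definable ψ r)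
  definable (φ □→ ψ) r = definable-by th-box r (defines-□→ r φ ψ) (definable φ r) (definable ψ r)
  definable (φ ◇→ ψ) r = definable-by th-dia r (defines-◇→ r φ ψ) (definable φ r) (definable ψ r)

  TruthAt : Form → ℕ → Set
  TruthAt φ m = ∀ {v} → w₀ ≼ v → (h : Assignment v) → ⟦ φ ⟧ (v , h m) ⇔ v ∣ h ⊩ ST m φ

  defines⇔⊩-comprehension : ∀ φ {m₁ m₂} → m₁ ≢ m₂ → TruthAt φ m₂ → ∀ {v} → w₀ ≼ v → (h : Assignment v)
                           → Defines ⟦ φ ⟧ v (h m₁) ⇔ v ∣ h ⊩ ∀O m₂ (Eᶠ m₂ m₁ ⇔ᶠ ST m₂ φ)
  defines⇔⊩-comprehension φ {m₁} {m₂} m₁≢m₂ truth {v} r h = mk⇔ forth back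
    where
    k : ∀ {v'} → v ≼ v' → D v' → Assignment v'
    k e c = transport e h [ m₂ ↦ c ]

    k-m₂ : ∀ {v'} (e : v ≼ v') c → k e c m₂ ≡ c
    k-m₂ e c = upd-≡ (transport e h) m₂ c

    k-m₁ : ∀ {v'} (e : v ≼ v') c → k e c m₁ ≡ H e (h m₁)
    k-m₁ e c = upd-≢ (transport e h) c m₁≢m₂

    forth : Defines ⟦ φ ⟧ v (h m₁) → v ∣ h ⊩ ∀O m₂ (Eᶠ m₂ m₁ ⇔ᶠ ST m₂ φ)
    forth d = ⊩-∀⇒-intro h m₂ (Oᶠ m₂) (Eᶠ m₂ m₁ ⇔ᶠ ST m₂ φ) λ v' e c Oc →
      ⊩-⇔-intro (k e c) (Eᶠ m₂ m₁) (ST m₂ φ) λ v'' e' →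
        let c' = H e' (k e c m₂)
        in truth (≼-trans r (≼-trans e e')) (transport e' (k e c))
           ⇔-∘ subst (λ t → Eᴵ c' (H e' t) ⇔ ⟦ φ ⟧ (v'' , c')) (sym (k-m₁ e c))
                     (defines-mono e d v'' e' c' (H-O e' Oc))

    back : v ∣ h ⊩ ∀O m₂ (Eᶠ m₂ m₁ ⇔ᶠ ST m₂ φ) → Defines ⟦ φ ⟧ v (h m₁)
    back comp v' e c Oc =
      subst₂ (λ c' t → Eᴵ c' t ⇔ ⟦ φ ⟧ (v' , c')) (k-m₂ e c) (k-m₁ e c)
        (⇔-sym (truth (≼-trans r e) (k e c))
         ⇔-∘ ⊩-⇔-elim (k e c) (Eᶠ m₂ m₁) (ST m₂ φ)
               (⊩-∀⇒-elim h m₂ (Oᶠ m₂) (Eᶠ m₂ m₁ ⇔ᶠ ST m₂ φ) comp v' e c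
                  (subst Oᴵ (sym (k-m₂ e c)) Oc)))

  truth-⇒ : ∀ φ ψ {n} → TruthAt φ n → TruthAt ψ n → TruthAt (φ ⇒ ψ) n
  truth-⇒ φ ψ {n} truthφ truthψ r h = mk⇔
    (λ f v' e φh → to (truthψ (≼-trans r e) (transport e h))
                     (f (v' , H e (h n)) (e , refl) (from (truthφ (≼-trans r e) (transport e h)) φh)))
    (λ { f (v' , _) (e , refl) φp → from (truthψ (≼-trans r e) (transport e h))
                                      (f v' e (to (truthφ (≼-trans r e) (transport e h)) φp)) })

  module _ (φ ψ : Form) {n : ℕ} (truthφ : TruthAt φ (2 + n)) (truthψ : TruthAt ψ (3 + n))
           {v} (r : w₀ ≼ v) (h : Assignment v) where

    private
      n₁ n₃ : ℕ
      n₁ = suc n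
      n₃ = 3 + n

      n≢n₁ : n ≢ n₁
      n≢n₁ = m≢1+n+m n

      n≢n₃ : n ≢ n₃
      n≢n₃ = m≢1+n+m n

      n₁≢n₃ : n₁ ≢ n₃
      n₁≢n₃ = m≢1+n+m n₁ {1}

      definer⇔ : ∀ s → Defines ⟦ φ ⟧ v ((h [ n₁ ↦ s ]) n₁)
                     ⇔ v ∣ h [ n₁ ↦ s ] ⊩ ∀O (2 + n) (Eᶠ (2 + n) n₁ ⇔ᶠ ST (2 + n) φ)
      definer⇔ s = defines⇔⊩-comprehension φ (m≢1+n+m n₁ {0}) truthφ r (h [ n₁ ↦ s ])

    truth-□→ : ⟦ φ □→ ψ ⟧ (v , h n) ⇔ v ∣ h ⊩ ST n (φ □→ ψ)
    truth-□→ = mk⇔ forth back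
      where
      module Frame {v'} (e : v ≼ v') (s : D v) (b : D v') where
        k : Assignment v'
        k = transport e (h [ n₁ ↦ s ]) [ n₃ ↦ b ]
        k-n : k n ≡ H e (h n)
        k-n = trans (upd-≢ _ b n≢n₃) (cong (H e) (upd-≢ h s n≢n₁))
        k-n₁ : k n₁ ≡ H e ((h [ n₁ ↦ s ]) n₁)
        k-n₁ = upd-≢ _ b n₁≢n₃

      forth : ⟦ φ □→ ψ ⟧ (v , h n) → v ∣ h ⊩ ST n (φ □→ ψ)
      forth f =
        let s , Ss , ds = definable φ r
            s≡ = upd-≡ h n₁ s
        in s , subst Sᴵ (sym s≡) Ss , to (definer⇔ s) (subst (Defines ⟦ φ ⟧ v) (sym s≡) ds)
         , ⊩-∀⇒-intro (h [ n₁ ↦ s ]) n₃ (Rᶠ n n₁ n₃) (ST n₃ ψ) λ v' e b Rk →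
             let open Frame e s b
                 r' = ≼-trans r e
             in to (truthψ r' k)
                  (f (v' , H e (h n)) (e , refl) (v' , k n₃)
                     (reach r' (H e s) (H-S e Ss) (defines-mono e ds)
                        (Rᴵ-resp k-n (trans k-n₁ (cong (H e) s≡)) refl Rk)))

      back : v ∣ h ⊩ ST n (φ □→ ψ) → ⟦ φ □→ ψ ⟧ (v , h n)
      back (s , Ss , comp , box) (v' , _) (e , refl) (_ , b) (reach r' t St dt Rt) =
        let open Frame e s b
            ds = from (definer⇔ s) comp
            t≡ = defines-unique r' St (H-S e Ss) dt (defines-mono e ds)
            ψk = ⊩-∀⇒-elim (h [ n₁ ↦ s ]) n₃ (Rᶠ n n₁ n₃) (ST n₃ ψ) box v' e b
                   (Rᴵ-resp (sym k-n) (trans t≡ (sym k-n₁)) (sym (upd-≡ _ n₃ b)) Rt)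
        in subst (λ b' → ⟦ ψ ⟧ (v' , b')) (upd-≡ _ n₃ b) (from (truthψ r' k) ψk)

    truth-◇→ : ⟦ φ ◇→ ψ ⟧ (v , h n) ⇔ v ∣ h ⊩ ST n (φ ◇→ ψ)
    truth-◇→ = mk⇔ forth back
      where
      module Frame (s : D v) (b : D v) where
        k : Assignment v
        k = h [ n₁ ↦ s ] [ n₃ ↦ b ]
        k-n : k n ≡ h n
        k-n = trans (upd-≢ _ b n≢n₃) (upd-≢ h s n≢n₁)
        k-n₁ : k n₁ ≡ (h [ n₁ ↦ s ]) n₁
        k-n₁ = upd-≢ _ b n₁≢n₃

      forth : ⟦ φ ◇→ ψ ⟧ (v , h n) → v ∣ h ⊩ ST n (φ ◇→ ψ)
      forth ((_ , b) , reach _ t St dt Rt , ψb) =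
        let open Frame t b
            t≡ = upd-≡ h n₁ t
            b≡ = upd-≡ (h [ n₁ ↦ t ]) n₃ b
        in t , subst Sᴵ (sym t≡) St , to (definer⇔ t) (subst (Defines ⟦ φ ⟧ v) (sym t≡) dt)
         , b , Rᴵ-resp (sym k-n) (sym (trans k-n₁ t≡)) (sym b≡) Rt
         , to (truthψ r k) (subst (λ b' → ⟦ ψ ⟧ (v , b')) (sym b≡) ψb)

      back : v ∣ h ⊩ ST n (φ ◇→ ψ) → ⟦ φ ◇→ ψ ⟧ (v , h n)
      back (s , Ss , comp , b , Rk , ψk) =
        let open Frame s b
        in (v , k n₃) , reach r _ Ss (from (definer⇔ s) comp) (Rᴵ-resp k-n k-n₁ refl Rk)
         , from (truthψ r k) ψk

  truth : ∀ φ n → TruthAt φ n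
  truth (var p)  n r h = mk⇔ id id
  truth ⊤'       n r h = mk⇔ id id
  truth ⊥'       n r h = mk⇔ id id
  truth (φ ∧ ψ)  n r h = truth φ n r h ×-⇔ truth ψ n r h
  truth (φ ∨ ψ)  n r h = truth φ n r h ⊎-⇔ truth ψ n r h
  truth (φ ⇒ ψ)  n r h = truth-⇒ φ ψ (truth φ n) (truth ψ n) r h
  truth (φ □→ ψ) n r h = truth-□→ φ ψ (truth φ (2 + n)) (truth ψ (3 + n)) r h
  truth (φ ◇→ ψ) n r h = truth-◇→ φ ψ (truth φ (2 + n)) (truth ψ (3 + n)) r h

corollary2 : (Γ Δ : Form → Set) (x : ℕ) → Γ ⊨ Δ → ThST x Γ ⊨fo STset x Δ
corollary2 Γ Δ x Γ⊨Δ 𝔎 w₀ g₀ ⊩Th∪STΓ ⊮STΔ =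
  Γ⊨Δ model (w₀ , g₀ x)
    (λ φ φ∈Γ → from (truth φ x ≼-refl g₀) (⊩Th∪STΓ _ (inj₂ (φ , φ∈Γ , refl))))
    (λ ψ ψ∈Δ ψ-true → ⊮STΔ _ (ψ , ψ∈Δ , refl) (to (truth ψ x ≼-refl g₀) ψ-true))
  where
  open KripkeSheaf 𝔎 using (≼-refl)
  open CanonicalModel 𝔎 w₀ g₀ (λ χ χ∈Th → ⊩Th∪STΓ χ (inj₁ χ∈Th))
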